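{- Let $\mathcal{M}$ be a matroid such that every pair of flats of $\mathcal{M}$ is modular. Then $\mathcal{M}$ has the $k$-fold circuit property for all $k\geq 1$.
   Context: Matroids have finite ground sets, rank $r$, closure $\mathrm{cl}(X)=\{x:r(X+x)=r(X)\}$; flats are sets with $\mathrm{cl}(F)=F$. Flats $X,Y$ form a modular pair if $r(X)+r(Y)=r(\mathrm{cl}(X\cup Y))+r(X\cap Y)$. A cyclic set is a set $D$ with $r(D-e)=r(D)$ for all $e\in D$; a $k$-fold circuit is a cyclic set with $r(D)=|D|-k$; its principal partition is $\{D\setminus B: B\subseteq D\text{ a }(k-1)\text{ -fold circuit}\}$; a $k$-fold circuit with principal partition $\{A_1,\dots,A_\ell\}$ is balanced if $r(\bigcap_{i=1}^\ell\mathrm{cl}(D\setminus A_i))=\ell-k$; a matroid has the $k$-fold circuit property if all its $k$-fold circuits are balanced. -}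

module Defs where

open import Data.Nat using (ℕ; suc; _+_; _≤_; _≟_)
open import Data.Fin using (Fin)
open import Data.Fin.Subset using (Subset; _∪_; _∩_; _─_; ⁅_⁆; ⊤; _⊆_; _∈_; ∣_∣)
open import Data.Vec using (tabulate)
open import Data.List using (List; foldr; length)
open import Data.List.Relation.Unary.Unique.Propositional using (Unique)
open import Data.List.Membership.Propositional using () renaming (_∈_ to _∈ₗ_)
open import Data.Product using (Σ; _×_; ∃)
open import Relation.Binary.PropositionalEquality using (_≡_)
open import Relation.Nullary.Decidable using (⌊_⌋)
open import Function.Bundles using (_⇔_)

record Matroid (n : ℕ) : Set where
  field
    rank      : Subset n → ℕ
    rank-≤    : ∀ X → rank X ≤ ∣ X ∣
    rank-mono : ∀ {X Y} → X ⊆ Y → rank X ≤ rank Y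
    rank-sub  : ∀ X Y → rank (X ∪ Y) + rank (X ∩ Y) ≤ rank X + rank Y

module _ {n : ℕ} (M : Matroid n) where
  open Matroid M

  cl : Subset n → Subset n
  cl X = tabulate (λ x → ⌊ rank (X ∪ ⁅ x ⁆) ≟ rank X ⌋)

  IsFlat : Subset n → Set
  IsFlat F = cl F ≡ F

  ModularPair : Subset n → Subset n → Set
  ModularPair X Y = rank X + rank Y ≡ rank (cl (X ∪ Y)) + rank (X ∩ Y)

  AllFlatsModular : Set
  AllFlatsModular = ∀ X Y → IsFlat X → IsFlat Y → ModularPair X Y

  Cyclic : Subset n → Set
  Cyclic D = ∀ e → e ∈ D → rank (D ─ ⁅ e ⁆) ≡ rank D

  -- k-fold circuit: cyclic with r(D) = |D| - k  (stated additively)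
  FoldCircuit : ℕ → Subset n → Set
  FoldCircuit k D = Cyclic D × (rank D + k ≡ ∣ D ∣)

  -- A is a block of the principal partition of the k-fold circuit D:
  -- A = D \ B for some (k-1)-fold circuit B ⊆ D.  (Used with k ≥ 1.)
  InPrincipalPartition : ℕ → Subset n → Subset n → Set
  InPrincipalPartition k D A =
    Σ (Subset n) (λ B → (B ⊆ D) × FoldCircuit k B × (A ≡ D ─ B))

  ⋂ : List (Subset n) → Subset n
  ⋂ = foldr _∩_ ⊤

  -- Balanced (for a (suc k)-fold circuit D): for the principal partition
  -- {A₁,…,A_ℓ}, enumerated without repetition by a list As,
  -- r(⋂ᵢ cl(D \ Aᵢ)) = ℓ - (suc k)  (stated additively).
  Balanced : ℕ → Subset n → Set
  Balanced k D =
    ∀ (As : List (Subset n)) → Unique As →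
    (∀ A → (A ∈ₗ As) ⇔ InPrincipalPartition k D A) →
    rank (⋂ (Data.List.map (λ A → cl (D ─ A)) As)) + suc k ≡ length As

  -- k-fold circuit property, for k = suc k'
  FoldCircuitProperty : ℕ → Set
  FoldCircuitProperty k = ∀ D → FoldCircuit (suc k) D → Balanced k D

{-# OPTIONS --safe #-}
module Submission where

-- Write ν(X) = |X| − r(X) for the nullity: it is monotone and supermodular, and a
-- k-fold circuit is a cyclic set of nullity k. Let D be a (k+1)-fold circuit. If
-- B, B' ⊆ D are k-fold circuits with f ∈ B' − B, then B ∪ B' = D: for e ∈ D − (B ∪ B'),
-- supermodularity would give 2k ≤ ν(B ∪ B') + ν(B ∩ B') ≤ ν(D − e) + ν(B' − f) = 2k − 1.
-- So the blocks A = D − B of the principal partition are pairwise disjoint; they cover D,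
-- because the cyclic part of D − e is a k-fold circuit missing e; and r(cl(D − A)) =
-- r(D) + 1 − |A|. The flats cl(D − A) and their intersections lie in cl(D), and any two
-- of them span D, so by modularity their coranks in cl(D) add up:
-- r(⋂ cl(D − Aᵢ)) = r(D) − Σ (|Aᵢ| − 1) = r(D) − |D| + ℓ = ℓ − (k + 1).

open import Defs
open import Data.Nat using (ℕ; suc; _+_; _∸_; _≤_; _<_)
open import Data.Nat.Properties
open import Data.Bool using (true)
open import Data.Fin using (Fin)
open import Data.Fin.Properties using (any?)
open import Data.Fin.Subset hiding (⋂)
open import Data.Fin.Subset.Properties
open import Data.Fin.Subset.Induction using (⊂-wellFounded; Acc; acc)
open import Data.Vec using ([]; _∷_; here; there; lookup)
open import Data.Vec.Properties using (lookup∘tabulate; []=⇒lookup; lookup⇒[]=)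
open import Data.Product using (∃; _×_; _,_; proj₁; proj₂)
open import Data.Sum using (_⊎_; inj₁; inj₂; [_,_]′)
import Data.Sum as Sum
open import Data.Empty using (⊥-elim)
open import Data.List using (List; []; _∷_; length; map)
open import Data.List.Membership.Propositional using () renaming (_∈_ to _∈ₗ_)
open import Data.List.Relation.Unary.Any using () renaming (here to hereₗ; there to thereₗ)
open import Data.List.Relation.Unary.All using (All; []; _∷_)
import Data.List.Relation.Unary.All as All
open import Data.List.Relation.Unary.AllPairs using (AllPairs; []; _∷_)
open import Data.List.Relation.Unary.Unique.Propositional using (Unique)
open import Function using (id; _∘_)
open import Function.Bundles using (_⇔_; mk⇔; Equivalence)
open import Relation.Nullary using (yes; no; does; ¬?; _×-dec_)
open import Relation.Nullary.Decidable using (⌊_⌋; isYes≗does; dec-true; decidable-stable)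
open import Relation.Binary.PropositionalEquality
open import Algebra.Properties.CommutativeSemigroup +-commutativeSemigroup
  using (interchange; xy∙z≈xz∙y; x∙yz≈y∙xz)

private
  variable
    n : ℕ
    p q r : Subset n
    x : Fin n

Disjoint : Subset n → Subset n → Set
Disjoint p q = Empty (p ∩ q)

x∈p─q⇒x∉q : x ∈ p ─ q → x ∉ q
x∈p─q⇒x∉q {p = s ∷ p} {inside ∷ q} (there x∈) (there x∈q) = x∈p─q⇒x∉q x∈ x∈q
x∈p─q⇒x∉q {p = s ∷ p} {outside ∷ q} (there x∈) (there x∈q) = x∈p─q⇒x∉q x∈ x∈q
x∈p─q⇒x∉q {p = s ∷ p} {outside ∷ q} here ()

∪-lub : p ⊆ r → q ⊆ r → p ∪ q ⊆ r
∪-lub {p = p} {q = q} p⊆r q⊆r = [ p⊆r , q⊆r ]′ ∘ x∈p∪q⁻ p q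

x∈p⇒⁅x⁆⊆p : x ∈ p → ⁅ x ⁆ ⊆ p
x∈p⇒⁅x⁆⊆p {x = x} {p} x∈p y∈⁅x⁆ = subst (_∈ p) (sym (x∈⁅y⁆⇒x≡y x y∈⁅x⁆)) x∈p

p⊆[p─q]∪q : ∀ (p q : Subset n) → p ⊆ (p ─ q) ∪ q
p⊆[p─q]∪q p q {x} x∈p with x ∈? q
... | yes x∈q = x∈p∪q⁺ (inj₂ x∈q)
... | no x∉q = x∈p∪q⁺ (inj₁ (x∈p∧x∉q⇒x∈p─q x∈p x∉q))

q⊆p⇒p∪q≡p : q ⊆ p → p ∪ q ≡ p
q⊆p⇒p∪q≡p {q = q} q⊆p = ⊆-antisym (∪-lub id q⊆p) (p⊆p∪q q)

q⊆p⇒p∩q≡q : q ⊆ p → p ∩ q ≡ q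
q⊆p⇒p∩q≡q {q = q} {p} q⊆p = ⊆-antisym (p∩q⊆q p q) (λ x∈q → x∈p∩q⁺ (q⊆p x∈q , x∈q))

q⊆p⇒p─[p─q]≡q : q ⊆ p → p ─ (p ─ q) ≡ q
q⊆p⇒p─[p─q]≡q {q = q} {p} q⊆p = ⊆-antisym ⊆q ⊇q
  where
  ⊇q : q ⊆ p ─ (p ─ q)
  ⊇q x∈q = x∈p∧x∉q⇒x∈p─q (q⊆p x∈q) (λ x∈p─q → x∈p─q⇒x∉q x∈p─q x∈q)
  ⊆q : p ─ (p ─ q) ⊆ q
  ⊆q {x} x∈ with x ∈? q
  ... | yes x∈q = x∈q
  ... | no x∉q = ⊥-elim (x∈p─q⇒x∉q x∈ (x∈p∧x∉q⇒x∈p─q (p─q⊆p p (p ─ q) x∈) x∉q))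

q⊆p⇒[p─q]∪q≡p : q ⊆ p → (p ─ q) ∪ q ≡ p
q⊆p⇒[p─q]∪q≡p {q = q} {p} q⊆p = ⊆-antisym (∪-lub (p─q⊆p p q) q⊆p) (p⊆[p─q]∪q p q)

⊆-or-witness : ∀ (p q : Subset n) → p ⊆ q ⊎ ∃ λ x → x ∈ p × x ∉ q
⊆-or-witness p q with any? (λ x → x ∈? p ×-dec ¬? (x ∈? q))
... | yes witness = inj₂ witness
... | no ¬witness = inj₁ λ {x} x∈p → decidable-stable (x ∈? q) (λ x∉q → ¬witness (x , x∈p , x∉q))

∣p∪q∣+∣p∩q∣≡∣p∣+∣q∣ : ∀ (p q : Subset n) → ∣ p ∪ q ∣ + ∣ p ∩ q ∣ ≡ ∣ p ∣ + ∣ q ∣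
∣p∪q∣+∣p∩q∣≡∣p∣+∣q∣ [] [] = refl
∣p∪q∣+∣p∩q∣≡∣p∣+∣q∣ (outside ∷ p) (outside ∷ q) = ∣p∪q∣+∣p∩q∣≡∣p∣+∣q∣ p q
∣p∪q∣+∣p∩q∣≡∣p∣+∣q∣ (inside ∷ p) (outside ∷ q) = cong suc (∣p∪q∣+∣p∩q∣≡∣p∣+∣q∣ p q)
∣p∪q∣+∣p∩q∣≡∣p∣+∣q∣ (outside ∷ p) (inside ∷ q) =
  trans (cong suc (∣p∪q∣+∣p∩q∣≡∣p∣+∣q∣ p q)) (sym (+-suc ∣ p ∣ ∣ q ∣))
∣p∪q∣+∣p∩q∣≡∣p∣+∣q∣ (inside ∷ p) (inside ∷ q) = cong suc (begin
  ∣ p ∪ q ∣ + suc ∣ p ∩ q ∣  ≡⟨ +-suc ∣ p ∪ q ∣ ∣ p ∩ q ∣ ⟩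
  suc (∣ p ∪ q ∣ + ∣ p ∩ q ∣) ≡⟨ cong suc (∣p∪q∣+∣p∩q∣≡∣p∣+∣q∣ p q) ⟩
  suc (∣ p ∣ + ∣ q ∣)         ≡⟨ +-suc ∣ p ∣ ∣ q ∣ ⟨
  ∣ p ∣ + suc ∣ q ∣           ∎)
  where open ≡-Reasoning

∣p∩q∣+∣p─q∣≡∣p∣ : ∀ (p q : Subset n) → ∣ p ∩ q ∣ + ∣ p ─ q ∣ ≡ ∣ p ∣
∣p∩q∣+∣p─q∣≡∣p∣ [] [] = refl
∣p∩q∣+∣p─q∣≡∣p∣ (outside ∷ p) (outside ∷ q) = ∣p∩q∣+∣p─q∣≡∣p∣ p q
∣p∩q∣+∣p─q∣≡∣p∣ (outside ∷ p) (inside ∷ q) = ∣p∩q∣+∣p─q∣≡∣p∣ p q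
∣p∩q∣+∣p─q∣≡∣p∣ (inside ∷ p) (outside ∷ q) =
  trans (+-suc ∣ p ∩ q ∣ ∣ p ─ q ∣) (cong suc (∣p∩q∣+∣p─q∣≡∣p∣ p q))
∣p∩q∣+∣p─q∣≡∣p∣ (inside ∷ p) (inside ∷ q) = cong suc (∣p∩q∣+∣p─q∣≡∣p∣ p q)

q⊆p⇒∣q∣+∣p─q∣≡∣p∣ : q ⊆ p → ∣ q ∣ + ∣ p ─ q ∣ ≡ ∣ p ∣
q⊆p⇒∣q∣+∣p─q∣≡∣p∣ {q = q} {p} q⊆p =
  subst (λ s → ∣ s ∣ + ∣ p ─ q ∣ ≡ ∣ p ∣) (q⊆p⇒p∩q≡q q⊆p) (∣p∩q∣+∣p─q∣≡∣p∣ p q)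

x∈p⇒suc∣p-x∣≡∣p∣ : x ∈ p → suc ∣ p - x ∣ ≡ ∣ p ∣
x∈p⇒suc∣p-x∣≡∣p∣ {x = x} {p} x∈p =
  subst (λ m → m + ∣ p - x ∣ ≡ ∣ p ∣) (∣⁅x⁆∣≡1 x) (q⊆p⇒∣q∣+∣p─q∣≡∣p∣ (x∈p⇒⁅x⁆⊆p x∈p))

Disjoint⇒∣p∪q∣≡∣p∣+∣q∣ : Disjoint p q → ∣ p ∪ q ∣ ≡ ∣ p ∣ + ∣ q ∣
Disjoint⇒∣p∪q∣≡∣p∣+∣q∣ {n} {p} {q} p#q = begin
  ∣ p ∪ q ∣              ≡⟨ +-identityʳ ∣ p ∪ q ∣ ⟨
  ∣ p ∪ q ∣ + 0          ≡⟨ cong (∣ p ∪ q ∣ +_) (trans (cong ∣_∣ (Empty-unique p#q)) (∣⊥∣≡0 n)) ⟨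
  ∣ p ∪ q ∣ + ∣ p ∩ q ∣  ≡⟨ ∣p∪q∣+∣p∩q∣≡∣p∣+∣q∣ p q ⟩
  ∣ p ∣ + ∣ q ∣          ∎
  where open ≡-Reasoning

∈⋃⁺ : ∀ {A} (As : List (Subset n)) → A ∈ₗ As → x ∈ A → x ∈ ⋃ As
∈⋃⁺ (A ∷ As) (hereₗ refl) x∈A = x∈p∪q⁺ (inj₁ x∈A)
∈⋃⁺ (A ∷ As) (thereₗ A∈As) x∈A = x∈p∪q⁺ (inj₂ (∈⋃⁺ As A∈As x∈A))

∈⋃⁻ : ∀ (As : List (Subset n)) → x ∈ ⋃ As → ∃ λ A → A ∈ₗ As × x ∈ A
∈⋃⁻ [] x∈⊥ = ⊥-elim (∉⊥ x∈⊥)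
∈⋃⁻ (A ∷ As) x∈ with x∈p∪q⁻ A (⋃ As) x∈
... | inj₁ x∈A = A , hereₗ refl , x∈A
... | inj₂ x∈⋃As with ∈⋃⁻ As x∈⋃As
... | A' , A'∈As , x∈A' = A' , thereₗ A'∈As , x∈A'

Disjoint-⋃ : ∀ {As} → All (Disjoint p) As → Disjoint p (⋃ As)
Disjoint-⋃ {p = p} {As} p#As (x , x∈) with x∈p∩q⁻ p (⋃ As) x∈
... | x∈p , x∈⋃As with ∈⋃⁻ As x∈⋃As
... | A , A∈As , x∈A = All.lookup p#As A∈As (x , x∈p∩q⁺ (x∈p , x∈A))

module _ (M : Matroid n) where
  open Matroid M

  rank-∪ : ∀ X Y → rank (X ∪ Y) ≤ rank X + rank Y
  rank-∪ X Y = ≤-trans (m≤m+n _ _) (rank-sub X Y)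

  rank[X]≤suc-rank[X-x] : ∀ X x → rank X ≤ suc (rank (X - x))
  rank[X]≤suc-rank[X-x] X x = begin
    rank X                       ≤⟨ rank-mono (p⊆[p─q]∪q X ⁅ x ⁆) ⟩
    rank ((X - x) ∪ ⁅ x ⁆)       ≤⟨ rank-∪ (X - x) ⁅ x ⁆ ⟩
    rank (X - x) + rank ⁅ x ⁆    ≤⟨ +-monoʳ-≤ (rank (X - x)) rank⁅x⁆≤1 ⟩
    rank (X - x) + 1             ≡⟨ +-comm (rank (X - x)) 1 ⟩
    suc (rank (X - x))           ∎
    where
    open ≤-Reasoning
    rank⁅x⁆≤1 : rank ⁅ x ⁆ ≤ 1
    rank⁅x⁆≤1 = ≤-trans (rank-≤ ⁅ x ⁆) (≤-reflexive (∣⁅x⁆∣≡1 x))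

  rank[X∪Z]≡rank[X]⇒rank[Y∪Z]≡rank[Y] : ∀ {X Y} Z → X ⊆ Y →
    rank (X ∪ Z) ≡ rank X → rank (Y ∪ Z) ≡ rank Y
  rank[X∪Z]≡rank[X]⇒rank[Y∪Z]≡rank[Y] {X} {Y} Z X⊆Y eq =
    ≤-antisym (+-cancelʳ-≤ (rank X) _ _ (begin
      rank (Y ∪ Z) + rank X                    ≤⟨ +-mono-≤ (rank-mono Y∪Z⊆) (rank-mono X⊆) ⟩
      rank (Y ∪ (X ∪ Z)) + rank (Y ∩ (X ∪ Z))  ≤⟨ rank-sub Y (X ∪ Z) ⟩
      rank Y + rank (X ∪ Z)                    ≡⟨ cong (rank Y +_) eq ⟩
      rank Y + rank X                          ∎))
      (rank-mono (p⊆p∪q Z))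
    where
    open ≤-Reasoning
    Y∪Z⊆ : Y ∪ Z ⊆ Y ∪ (X ∪ Z)
    Y∪Z⊆ = x∈p∪q⁺ ∘ Sum.map₂ (q⊆p∪q X Z) ∘ x∈p∪q⁻ Y Z
    X⊆ : X ⊆ Y ∩ (X ∪ Z)
    X⊆ x∈X = x∈p∩q⁺ (X⊆Y x∈X , p⊆p∪q Z x∈X)

  ∈-cl⁺ : ∀ {X x} → rank (X ∪ ⁅ x ⁆) ≡ rank X → x ∈ cl M X
  ∈-cl⁺ {X} {x} eq = lookup⇒[]= x (cl M X) (begin
    lookup (cl M X) x               ≡⟨ lookup∘tabulate _ x ⟩
    ⌊ rank (X ∪ ⁅ x ⁆) ≟ rank X ⌋  ≡⟨ isYes≗does (rank (X ∪ ⁅ x ⁆) ≟ rank X) ⟩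
    does (rank (X ∪ ⁅ x ⁆) ≟ rank X) ≡⟨ dec-true (rank (X ∪ ⁅ x ⁆) ≟ rank X) eq ⟩
    true                              ∎)
    where open ≡-Reasoning

  ∈-cl⁻ : ∀ {X x} → x ∈ cl M X → rank (X ∪ ⁅ x ⁆) ≡ rank X
  ∈-cl⁻ {X} {x} x∈ with rank (X ∪ ⁅ x ⁆) ≟ rank X | trans (sym (lookup∘tabulate _ x)) ([]=⇒lookup x∈)
  ... | yes eq | _  = eq
  ... | no _   | ()

  cl-extensive : ∀ {X} → X ⊆ cl M X
  cl-extensive {X} x∈X = ∈-cl⁺ (cong rank (q⊆p⇒p∪q≡p (x∈p⇒⁅x⁆⊆p x∈X)))

  cl-mono : ∀ {X Y} → X ⊆ Y → cl M X ⊆ cl M Y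
  cl-mono X⊆Y {x} x∈ = ∈-cl⁺ (rank[X∪Z]≡rank[X]⇒rank[Y∪Z]≡rank[Y] ⁅ x ⁆ X⊆Y (∈-cl⁻ x∈))

  rank[X∪S]≡rank[X] : ∀ {X S} → S ⊆ cl M X → rank (X ∪ S) ≡ rank X
  rank[X∪S]≡rank[X] {X} {S} = go S (⊂-wellFounded S)
    where
    go : ∀ S → Acc _⊂_ S → S ⊆ cl M X → rank (X ∪ S) ≡ rank X
    go S (acc rec) S⊆ with nonempty? S
    ... | no empty = cong rank (trans (cong (X ∪_) (Empty-unique empty)) (∪-identityʳ X))
    ... | yes (x , x∈S) = begin
      rank (X ∪ S)
        ≡⟨ cong (λ T → rank (X ∪ T)) (q⊆p⇒[p─q]∪q≡p (x∈p⇒⁅x⁆⊆p x∈S)) ⟨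
      rank (X ∪ ((S - x) ∪ ⁅ x ⁆))
        ≡⟨ cong rank (∪-assoc X (S - x) ⁅ x ⁆) ⟨
      rank ((X ∪ (S - x)) ∪ ⁅ x ⁆)
        ≡⟨ rank[X∪Z]≡rank[X]⇒rank[Y∪Z]≡rank[Y] ⁅ x ⁆ (p⊆p∪q (S - x)) (∈-cl⁻ (S⊆ x∈S)) ⟩
      rank (X ∪ (S - x))
        ≡⟨ go (S - x) (rec (x∈p⇒p-x⊂p x∈S)) (S⊆ ∘ p─q⊆p S ⁅ x ⁆) ⟩
      rank X
        ∎
      where open ≡-Reasoning

  rank-cl : ∀ X → rank (cl M X) ≡ rank X
  rank-cl X = trans (cong rank clX≡X∪clX) (rank[X∪S]≡rank[X] id)
    where
    clX≡X∪clX : cl M X ≡ X ∪ cl M X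
    clX≡X∪clX = sym (trans (∪-comm X (cl M X)) (q⊆p⇒p∪q≡p cl-extensive))

  cl-idempotent : ∀ X → cl M (cl M X) ≡ cl M X
  cl-idempotent X = ⊆-antisym cl[clX]⊆clX cl-extensive
    where
    cl[clX]⊆clX : cl M (cl M X) ⊆ cl M X
    cl[clX]⊆clX {x} x∈ = ∈-cl⁺ (≤-antisym (begin
      rank (X ∪ ⁅ x ⁆)       ≤⟨ rank-mono (∪-lub (p⊆p∪q ⁅ x ⁆ ∘ cl-extensive) (q⊆p∪q (cl M X) ⁅ x ⁆)) ⟩
      rank (cl M X ∪ ⁅ x ⁆)  ≡⟨ ∈-cl⁻ x∈ ⟩
      rank (cl M X)          ≡⟨ rank-cl X ⟩
      rank X                 ∎) (rank-mono (p⊆p∪q ⁅ x ⁆)))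
      where open ≤-Reasoning

  ∩-isFlat : ∀ {F G} → IsFlat M F → IsFlat M G → IsFlat M (F ∩ G)
  ∩-isFlat {F} {G} F-flat G-flat = ⊆-antisym cl[F∩G]⊆F∩G cl-extensive
    where
    cl[F∩G]⊆F∩G : cl M (F ∩ G) ⊆ F ∩ G
    cl[F∩G]⊆F∩G x∈ = x∈p∩q⁺ ( subst (_ ∈_) F-flat (cl-mono (p∩q⊆p F G) x∈)
                            , subst (_ ∈_) G-flat (cl-mono (p∩q⊆q F G) x∈))

  ⊤-isFlat : IsFlat M ⊤
  ⊤-isFlat = ⊆-antisym (λ _ → ∈⊤) cl-extensive

  nullity : Subset n → ℕ
  nullity X = ∣ X ∣ ∸ rank X

  rank+nullity≡∣X∣ : ∀ X → rank X + nullity X ≡ ∣ X ∣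
  rank+nullity≡∣X∣ X = m+[n∸m]≡n (rank-≤ X)

  rank+k≡∣X∣⇔nullity≡k : ∀ {X k} → rank X + k ≡ ∣ X ∣ ⇔ nullity X ≡ k
  rank+k≡∣X∣⇔nullity≡k {X} {k} = mk⇔
    (λ eq → trans (cong (_∸ rank X) (sym eq)) (m+n∸m≡n (rank X) k))
    (λ eq → trans (cong (rank X +_) (sym eq)) (rank+nullity≡∣X∣ X))

  nullity-supermodular : ∀ X Y → nullity X + nullity Y ≤ nullity (X ∪ Y) + nullity (X ∩ Y)
  nullity-supermodular X Y = +-cancelˡ-≤ (rank X + rank Y) _ _ (begin
    (rank X + rank Y) + (nullity X + nullity Y)
      ≡⟨ interchange (rank X) (rank Y) (nullity X) (nullity Y) ⟩
    (rank X + nullity X) + (rank Y + nullity Y)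
      ≡⟨ cong₂ _+_ (rank+nullity≡∣X∣ X) (rank+nullity≡∣X∣ Y) ⟩
    ∣ X ∣ + ∣ Y ∣
      ≡⟨ ∣p∪q∣+∣p∩q∣≡∣p∣+∣q∣ X Y ⟨
    ∣ X ∪ Y ∣ + ∣ X ∩ Y ∣
      ≡⟨ cong₂ _+_ (rank+nullity≡∣X∣ (X ∪ Y)) (rank+nullity≡∣X∣ (X ∩ Y)) ⟨
    (rank (X ∪ Y) + nullity (X ∪ Y)) + (rank (X ∩ Y) + nullity (X ∩ Y))
      ≡⟨ interchange (rank (X ∪ Y)) (nullity (X ∪ Y)) (rank (X ∩ Y)) (nullity (X ∩ Y)) ⟩
    (rank (X ∪ Y) + rank (X ∩ Y)) + (nullity (X ∪ Y) + nullity (X ∩ Y))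
      ≤⟨ +-monoˡ-≤ _ (rank-sub X Y) ⟩
    (rank X + rank Y) + (nullity (X ∪ Y) + nullity (X ∩ Y)) ∎)
    where open ≤-Reasoning

  nullity-mono : ∀ {X Y} → X ⊆ Y → nullity X ≤ nullity Y
  nullity-mono {X} {Y} X⊆Y = begin
    ∣ X ∣ ∸ rank X                              ≡⟨ [m+n]∸[m+o]≡n∸o ∣ Y ─ X ∣ ∣ X ∣ (rank X) ⟨
    (∣ Y ─ X ∣ + ∣ X ∣) ∸ (∣ Y ─ X ∣ + rank X)  ≡⟨ cong (_∸ (∣ Y ─ X ∣ + rank X)) ∣Y─X∣+∣X∣≡∣Y∣ ⟩
    ∣ Y ∣ ∸ (∣ Y ─ X ∣ + rank X)                ≤⟨ ∸-monoʳ-≤ ∣ Y ∣ rank[Y]≤ ⟩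
    ∣ Y ∣ ∸ rank Y                              ∎
    where
    open ≤-Reasoning
    ∣Y─X∣+∣X∣≡∣Y∣ : ∣ Y ─ X ∣ + ∣ X ∣ ≡ ∣ Y ∣
    ∣Y─X∣+∣X∣≡∣Y∣ = trans (+-comm ∣ Y ─ X ∣ ∣ X ∣) (q⊆p⇒∣q∣+∣p─q∣≡∣p∣ X⊆Y)
    rank[Y]≤ : rank Y ≤ ∣ Y ─ X ∣ + rank X
    rank[Y]≤ = ≤-trans (rank-mono (p⊆[p─q]∪q Y X))
                 (≤-trans (rank-∪ (Y ─ X) X) (+-monoˡ-≤ (rank X) (rank-≤ (Y ─ X))))

  nullity-deleteNonColoop : ∀ {X x} → x ∈ X → rank (X - x) ≡ rank X →
    nullity X ≡ suc (nullity (X - x))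
  nullity-deleteNonColoop {X} {x} x∈X rank≡ = begin
    ∣ X ∣ ∸ rank X                ≡⟨ cong₂ _∸_ (x∈p⇒suc∣p-x∣≡∣p∣ x∈X) rank≡ ⟨
    suc ∣ X - x ∣ ∸ rank (X - x)  ≡⟨ +-∸-assoc 1 (rank-≤ (X - x)) ⟩
    suc (nullity (X - x))         ∎
    where open ≡-Reasoning

  nullity-deleteColoop : ∀ {X x} → x ∈ X → suc (rank (X - x)) ≡ rank X → nullity X ≡ nullity (X - x)
  nullity-deleteColoop x∈X rank≡ = sym (cong₂ _∸_ (x∈p⇒suc∣p-x∣≡∣p∣ x∈X) rank≡)

  cyclic-or-coloop : ∀ X → Cyclic M X ⊎ ∃ λ x → x ∈ X × suc (rank (X - x)) ≡ rank X
  cyclic-or-coloop X with any? (λ x → x ∈? X ×-dec ¬? (rank (X - x) ≟ rank X))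
  ... | yes (x , x∈X , rank≢) =
    inj₂ (x , x∈X , ≤-antisym (≤∧≢⇒< (rank-mono (p─q⊆p X ⁅ x ⁆)) rank≢) (rank[X]≤suc-rank[X-x] X x))
  ... | no ¬coloop =
    inj₁ λ x x∈X → decidable-stable (rank (X - x) ≟ rank X) (λ rank≢ → ¬coloop (x , x∈X , rank≢))

  cyclicPart : ∀ X → ∃ λ Y → Y ⊆ X × Cyclic M Y × nullity Y ≡ nullity X
  cyclicPart X = go X (⊂-wellFounded X)
    where
    go : ∀ X → Acc _⊂_ X → ∃ λ Y → Y ⊆ X × Cyclic M Y × nullity Y ≡ nullity X
    go X (acc rec) with cyclic-or-coloop X
    ... | inj₁ cyclic = X , id , cyclic , refl
    ... | inj₂ (x , x∈X , coloop) with go (X - x) (rec (x∈p⇒p-x⊂p x∈X))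
    ... | Y , Y⊆X-x , cyclic , nullity≡ =
      Y , p─q⊆p X ⁅ x ⁆ ∘ Y⊆X-x , cyclic , trans nullity≡ (sym (nullity-deleteColoop x∈X coloop))

  module _ (modular : AllFlatsModular M) where

    rank-∩-of-flats-spanning : ∀ {D F G} → IsFlat M F → IsFlat M G →
      D ⊆ F ∪ G → F ∪ G ⊆ cl M D → rank F + rank G ≡ rank D + rank (F ∩ G)
    rank-∩-of-flats-spanning {D} {F} {G} F-flat G-flat D⊆F∪G F∪G⊆clD =
      trans (modular F G F-flat G-flat) (cong (_+ rank (F ∩ G)) rank[cl[F∪G]]≡rank[D])
      where
      open ≤-Reasoning
      rank[cl[F∪G]]≡rank[D] : rank (cl M (F ∪ G)) ≡ rank D
      rank[cl[F∪G]]≡rank[D] = ≤-antisym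
        (begin
          rank (cl M (F ∪ G))  ≡⟨ rank-cl (F ∪ G) ⟩
          rank (F ∪ G)         ≤⟨ rank-mono F∪G⊆clD ⟩
          rank (cl M D)        ≡⟨ rank-cl D ⟩
          rank D               ∎)
        (rank-mono (cl-extensive ∘ D⊆F∪G))

    module _ (D : Subset n) where

      complementFlat : Subset n → Subset n
      complementFlat A = cl M (D ─ A)

      ⋂-complementFlats-isFlat : ∀ As → IsFlat M (⋂ M (map complementFlat As))
      ⋂-complementFlats-isFlat []       = ⊤-isFlat
      ⋂-complementFlats-isFlat (A ∷ As) = ∩-isFlat (cl-idempotent (D ─ A)) (⋂-complementFlats-isFlat As)

      D─⋃⊆⋂-complementFlats : ∀ As → D ─ ⋃ As ⊆ ⋂ M (map complementFlat As)
      D─⋃⊆⋂-complementFlats []       _  = ∈⊤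
      D─⋃⊆⋂-complementFlats (A ∷ As) {x} x∈ =
        x∈p∩q⁺ ( cl-extensive (x∈p∧x∉q⇒x∈p─q x∈D (x∉A∪⋃As ∘ p⊆p∪q (⋃ As)))
               , D─⋃⊆⋂-complementFlats As (x∈p∧x∉q⇒x∈p─q x∈D (x∉A∪⋃As ∘ q⊆p∪q A (⋃ As))))
        where
        x∈D : x ∈ D
        x∈D = p─q⊆p D (A ∪ ⋃ As) x∈
        x∉A∪⋃As : x ∉ A ∪ ⋃ As
        x∉A∪⋃As = x∈p─q⇒x∉q x∈

      rank-⋂-complementFlats : ∀ A As → AllPairs Disjoint (A ∷ As) →
        All (λ B → rank (complementFlat B) + ∣ B ∣ ≡ suc (rank D)) (A ∷ As) →
        rank (⋂ M (map complementFlat (A ∷ As))) + ∣ ⋃ (A ∷ As) ∣ ≡ rank D + length (A ∷ As)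
      rank-⋂-complementFlats A [] _ (rank[A] ∷ []) = begin
        rank (complementFlat A ∩ ⊤) + ∣ A ∪ ⊥ ∣
          ≡⟨ cong₂ (λ S T → rank S + ∣ T ∣) (∩-identityʳ (complementFlat A)) (∪-identityʳ A) ⟩
        rank (complementFlat A) + ∣ A ∣  ≡⟨ rank[A] ⟩
        suc (rank D)                     ≡⟨ +-comm 1 (rank D) ⟩
        rank D + 1                       ∎
        where open ≡-Reasoning
      rank-⋂-complementFlats A (A' ∷ As) (A#A'∷As ∷ disjoint) (rank[A] ∷ ranks) =
        +-cancelˡ-≡ (rank D) _ _ (begin
          rank D + (rank (F ∩ G) + ∣ A ∪ U ∣)
            ≡⟨ cong (λ m → rank D + (rank (F ∩ G) + m)) (Disjoint⇒∣p∪q∣≡∣p∣+∣q∣ A#U) ⟩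
          rank D + (rank (F ∩ G) + (∣ A ∣ + ∣ U ∣))
            ≡⟨ +-assoc (rank D) (rank (F ∩ G)) (∣ A ∣ + ∣ U ∣) ⟨
          (rank D + rank (F ∩ G)) + (∣ A ∣ + ∣ U ∣)
            ≡⟨ cong (_+ (∣ A ∣ + ∣ U ∣)) modularity ⟨
          (rank F + rank G) + (∣ A ∣ + ∣ U ∣)
            ≡⟨ interchange (rank F) (rank G) ∣ A ∣ ∣ U ∣ ⟩
          (rank F + ∣ A ∣) + (rank G + ∣ U ∣)
            ≡⟨ cong₂ _+_ rank[A] (rank-⋂-complementFlats A' As disjoint ranks) ⟩
          suc (rank D) + (rank D + L)
            ≡⟨ trans (cong (rank D +_) (+-suc (rank D) L)) (+-suc (rank D) (rank D + L)) ⟨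
          rank D + (rank D + suc L)
            ∎)
        where
        open ≡-Reasoning
        F G U : Subset n
        F = complementFlat A
        G = ⋂ M (map complementFlat (A' ∷ As))
        U = ⋃ (A' ∷ As)
        L : ℕ
        L = length (A' ∷ As)
        A#U : Disjoint A U
        A#U = Disjoint-⋃ A#A'∷As
        D⊆F∪G : D ⊆ F ∪ G
        D⊆F∪G {x} x∈D with x ∈? A
        ... | yes x∈A = x∈p∪q⁺ (inj₂ (D─⋃⊆⋂-complementFlats (A' ∷ As)
                          (x∈p∧x∉q⇒x∈p─q x∈D (λ x∈U → A#U (x , x∈p∩q⁺ (x∈A , x∈U))))))
        ... | no x∉A = x∈p∪q⁺ (inj₁ (cl-extensive (x∈p∧x∉q⇒x∈p─q x∈D x∉A)))
        F∪G⊆clD : F ∪ G ⊆ cl M D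
        F∪G⊆clD = ∪-lub (cl-mono (p─q⊆p D A))
                        (cl-mono (p─q⊆p D A') ∘ p∩q⊆p (complementFlat A') (⋂ M (map complementFlat As)))
        modularity : rank F + rank G ≡ rank D + rank (F ∩ G)
        modularity = rank-∩-of-flats-spanning (cl-idempotent (D ─ A))
                       (⋂-complementFlats-isFlat (A' ∷ As)) D⊆F∪G F∪G⊆clD

  module PrincipalPartition {k : ℕ} {D : Subset n} (D-circuit : FoldCircuit M (suc k) D) where

    Block : Subset n → Set
    Block = InPrincipalPartition M k D

    nullity[D-x]≡k : ∀ {x} → x ∈ D → nullity (D - x) ≡ k
    nullity[D-x]≡k {x} x∈D = suc-injective (trans
      (sym (nullity-deleteNonColoop x∈D (proj₁ D-circuit x x∈D)))
      (Equivalence.to rank+k≡∣X∣⇔nullity≡k (proj₂ D-circuit)))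

    foldCircuits-span : ∀ {B B' f} → B ⊆ D → B' ⊆ D → FoldCircuit M k B → FoldCircuit M k B' →
      f ∈ B' → f ∉ B → D ⊆ B ∪ B'
    foldCircuits-span {B} {B'} {f} B⊆D B'⊆D (_ , rank[B]) (B'-cyclic , rank[B']) f∈B' f∉B {x} x∈D
      with x ∈? B ∪ B'
    ... | yes x∈B∪B' = x∈B∪B'
    ... | no x∉B∪B' = ⊥-elim (<-irrefl refl (begin-strict
      k + k                                ≡⟨ cong₂ _+_ nullity[B] nullity[B'] ⟨
      nullity B + nullity B'               ≤⟨ nullity-supermodular B B' ⟩
      nullity (B ∪ B') + nullity (B ∩ B')  <⟨ +-mono-≤-< nullity[B∪B']≤k nullity[B∩B']<k ⟩
      k + k                                ∎))
      where
      open ≤-Reasoning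
      nullity[B] : nullity B ≡ k
      nullity[B] = Equivalence.to rank+k≡∣X∣⇔nullity≡k rank[B]
      nullity[B'] : nullity B' ≡ k
      nullity[B'] = Equivalence.to rank+k≡∣X∣⇔nullity≡k rank[B']
      B∪B'⊆D-x : B ∪ B' ⊆ D - x
      B∪B'⊆D-x y∈ = x∈p∧x≢y⇒x∈p-y (∪-lub B⊆D B'⊆D y∈) λ { refl → x∉B∪B' y∈ }
      B∩B'⊆B'-f : B ∩ B' ⊆ B' - f
      B∩B'⊆B'-f y∈ = x∈p∧x≢y⇒x∈p-y (p∩q⊆q B B' y∈) λ { refl → f∉B (p∩q⊆p B B' y∈) }
      nullity[B∪B']≤k : nullity (B ∪ B') ≤ k
      nullity[B∪B']≤k = begin
        nullity (B ∪ B')  ≤⟨ nullity-mono B∪B'⊆D-x ⟩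
        nullity (D - x)   ≡⟨ nullity[D-x]≡k x∈D ⟩
        k                 ∎
      nullity[B∩B']<k : nullity (B ∩ B') < k
      nullity[B∩B']<k = begin-strict
        nullity (B ∩ B')       ≤⟨ nullity-mono B∩B'⊆B'-f ⟩
        nullity (B' - f)       <⟨ n<1+n _ ⟩
        suc (nullity (B' - f)) ≡⟨ nullity-deleteNonColoop f∈B' (B'-cyclic f f∈B') ⟨
        nullity B'             ≡⟨ nullity[B'] ⟩
        k                      ∎

    blocks-disjoint : ∀ {A A'} → Block A → Block A' → A ≢ A' → Disjoint A A'
    blocks-disjoint (B , B⊆D , B-circuit , refl) (B' , B'⊆D , B'-circuit , refl) A≢A' (x , x∈)
      with x∈p∩q⁻ (D ─ B) (D ─ B') x∈
    ... | x∈D─B , x∈D─B' =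
      [ x∈p─q⇒x∉q x∈D─B , x∈p─q⇒x∉q x∈D─B' ]′ (x∈p∪q⁻ B B' (D⊆B∪B' (p─q⊆p D B x∈D─B)))
      where
      D⊆B∪B' : D ⊆ B ∪ B'
      D⊆B∪B' with ⊆-or-witness B' B | ⊆-or-witness B B'
      ... | inj₂ (f , f∈B' , f∉B) | _ = foldCircuits-span B⊆D B'⊆D B-circuit B'-circuit f∈B' f∉B
      ... | inj₁ _ | inj₂ (f , f∈B , f∉B') =
        subst (D ⊆_) (∪-comm B' B) (foldCircuits-span B'⊆D B⊆D B'-circuit B-circuit f∈B f∉B')
      ... | inj₁ B'⊆B | inj₁ B⊆B' = ⊥-elim (A≢A' (cong (D ─_) (⊆-antisym B⊆B' B'⊆B)))

    block-containing : ∀ {x} → x ∈ D → ∃ λ A → Block A × x ∈ A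
    block-containing {x} x∈D with cyclicPart (D - x)
    ... | B , B⊆D-x , B-cyclic , nullity≡ =
      D ─ B , (B , p─q⊆p D ⁅ x ⁆ ∘ B⊆D-x , (B-cyclic , rank[B]) , refl) ,
      x∈p∧x∉q⇒x∈p─q x∈D (λ x∈B → x∈p─q⇒x∉q (B⊆D-x x∈B) (x∈⁅x⁆ x))
      where
      rank[B] : rank B + k ≡ ∣ B ∣
      rank[B] = Equivalence.from rank+k≡∣X∣⇔nullity≡k (trans nullity≡ (nullity[D-x]≡k x∈D))

    block-rank : ∀ {A} → Block A → rank (cl M (D ─ A)) + ∣ A ∣ ≡ suc (rank D)
    block-rank (B , B⊆D , (_ , rank[B]) , refl) = +-cancelʳ-≡ k _ _ (begin
      rank (cl M (D ─ (D ─ B))) + ∣ D ─ B ∣ + k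
        ≡⟨ cong (λ m → m + ∣ D ─ B ∣ + k) rank[cl[D─[D─B]]]≡rank[B] ⟩
      rank B + ∣ D ─ B ∣ + k    ≡⟨ xy∙z≈xz∙y (rank B) ∣ D ─ B ∣ k ⟩
      rank B + k + ∣ D ─ B ∣    ≡⟨ cong (_+ ∣ D ─ B ∣) rank[B] ⟩
      ∣ B ∣ + ∣ D ─ B ∣         ≡⟨ q⊆p⇒∣q∣+∣p─q∣≡∣p∣ B⊆D ⟩
      ∣ D ∣                     ≡⟨ proj₂ D-circuit ⟨
      rank D + suc k            ≡⟨ +-suc (rank D) k ⟩
      suc (rank D) + k          ∎)
      where
      open ≡-Reasoning
      rank[cl[D─[D─B]]]≡rank[B] : rank (cl M (D ─ (D ─ B))) ≡ rank B
      rank[cl[D─[D─B]]]≡rank[B] = trans (cong (rank ∘ cl M) (q⊆p⇒p─[p─q]≡q B⊆D)) (rank-cl B)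

    D≡⋃blocks : ∀ {As} → (∀ A → A ∈ₗ As ⇔ Block A) → D ≡ ⋃ As
    D≡⋃blocks {As} As⇔blocks = ⊆-antisym D⊆⋃As ⋃As⊆D
      where
      D⊆⋃As : D ⊆ ⋃ As
      D⊆⋃As x∈D with block-containing x∈D
      ... | A , A-block , x∈A = ∈⋃⁺ As (Equivalence.from (As⇔blocks A) A-block) x∈A
      ⋃As⊆D : ⋃ As ⊆ D
      ⋃As⊆D x∈ with ∈⋃⁻ As x∈
      ... | A , A∈As , x∈A with Equivalence.to (As⇔blocks A) A∈As
      ... | B , _ , _ , refl = p─q⊆p D B x∈A

    distinctBlocks-disjoint : ∀ {As} → All Block As → Unique As → AllPairs Disjoint As
    distinctBlocks-disjoint [] [] = []
    distinctBlocks-disjoint (A-block ∷ blocks) (A∉As ∷ unique) =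
      All.zipWith (λ (A'-block , A≢A') → blocks-disjoint A-block A'-block A≢A') (blocks , A∉As)
      ∷ distinctBlocks-disjoint blocks unique

mainTheorem19 : ∀ {n : ℕ} (M : Matroid n) → AllFlatsModular M →
    ∀ (k : ℕ) → FoldCircuitProperty M k
mainTheorem19 {n} M modular k D D-circuit [] _ []⇔blocks =
  ⊥-elim (m+1+n≢0 (rank D) (begin
    rank D + suc k  ≡⟨ proj₂ D-circuit ⟩
    ∣ D ∣           ≡⟨ cong ∣_∣ (D≡⋃blocks []⇔blocks) ⟩
    ∣ ⊥ {n} ∣       ≡⟨ ∣⊥∣≡0 n ⟩
    0               ∎))
  where
  open Matroid M
  open PrincipalPartition M D-circuit
  open ≡-Reasoning
mainTheorem19 M modular k D D-circuit (A ∷ As) unique As⇔blocks = +-cancelˡ-≡ (rank D) _ _ (begin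
  rank D + (rank N + suc k)  ≡⟨ x∙yz≈y∙xz (rank D) (rank N) (suc k) ⟩
  rank N + (rank D + suc k)  ≡⟨ cong (rank N +_) (proj₂ D-circuit) ⟩
  rank N + ∣ D ∣             ≡⟨ cong (λ S → rank N + ∣ S ∣) (D≡⋃blocks As⇔blocks) ⟩
  rank N + ∣ ⋃ (A ∷ As) ∣    ≡⟨ rank-⋂-complementFlats M modular D A As
                                  (distinctBlocks-disjoint blocks unique) (All.map block-rank blocks) ⟩
  rank D + length (A ∷ As)   ∎)
  where
  open Matroid M
  open PrincipalPartition M D-circuit
  open ≡-Reasoning
  N : Subset _
  N = ⋂ M (map (λ A → cl M (D ─ A)) (A ∷ As))
  blocks : All Block (A ∷ As)
  blocks = All.tabulate (λ {A'} A'∈ → Equivalence.to (As⇔blocks A') A'∈)
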